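{- For positive integers $a$ and $b$, let $S_{a,b}$ be the double star: the tree on $a+b+2$ vertices consisting of an edge $\{u,v\}$ together with $a$ further vertices adjacent only to $u$ and $b$ further vertices adjacent only to $v$ (so $|N(u)\setminus\{v\}|=a$, $|N(v)\setminus\{u\}|=b$, $N(u)\cap N(v)=\varnothing$). Then for every $n$, \[ \mathrm{ex}^c(n,S_{a,b})\le \frac{a+b}{2}\,n . \]
   Context: For a tree $T$, $\mathrm{ex}^c(n,T)$ denotes the maximum number of edges of an $n$-vertex graph $G$ that admits a proper vertex coloring (with any number of colors) such that in every copy of $T$ in $G$ (every subgraph of $G$ isomorphic to $T$), all leaves of that copy have the same color. -}

module Defs where

open import Data.Nat using (ℕ; zero; suc; _+_; _≡ᵇ_; _≤ᵇ_)
open import Data.Bool using (Bool; true; false; _∧_; _∨_)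
open import Data.Fin using (Fin; toℕ; _<_)
open import Data.Fin.Properties using (_<?_)
open import Data.List using (List; length; filterᵇ; allFin; concatMap; map)
open import Data.Product using (_×_; _,_)
open import Function.Definitions using (Injective)
open import Relation.Binary.PropositionalEquality using (_≡_; _≢_)
open import Relation.Nullary.Decidable using (Dec; yes; no; does)

record Graph (n : ℕ) : Set where
  field
    adj : Fin n → Fin n → Bool
open Graph public

Adj : ∀ {n} → Graph n → Fin n → Fin n → Set
Adj G i j = adj G i j ≡ true

IsSimple : ∀ {n} → Graph n → Set
IsSimple {n} G = (∀ (i j : Fin n) → adj G i j ≡ adj G j i) × (∀ (i : Fin n) → adj G i i ≡ false)

numEdges : ∀ {n} → Graph n → ℕ
numEdges {n} G =
  length (filterᵇ (λ p → adjPair p)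
    (concatMap (λ i → map (λ j → (i , j)) (allFin n)) (allFin n)))
  where
  adjPair : Fin n × Fin n → Bool
  adjPair (i , j) = does (i <? j) ∧ adj G i j

degree : ∀ {n} → Graph n → Fin n → ℕ
degree {n} G v = length (filterᵇ (λ j → adj G v j) (allFin n))

IsLeaf : ∀ {m} → Graph m → Fin m → Set
IsLeaf T x = degree T x ≡ 1

ProperColoring : ∀ {n} → Graph n → (Fin n → ℕ) → Set
ProperColoring {n} G c = ∀ (i j : Fin n) → Adj G i j → c i ≢ c j

-- A copy of T in G (a subgraph of G isomorphic to T) is the image of an
-- injective edge-preserving map V(T) → V(G); the leaves of the copy are
-- the images of the leaves of T.
IsCopy : ∀ {m n} → Graph m → Graph n → (Fin m → Fin n) → Set
IsCopy {m} T G f = Injective _≡_ _≡_ f × (∀ (x y : Fin m) → Adj T x y → Adj G (f x) (f y))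

LeavesMonochromatic : ∀ {m n} → Graph m → Graph n → (Fin n → ℕ) → Set
LeavesMonochromatic {m} {n} T G c =
  ∀ (f : Fin m → Fin n) → IsCopy T G f →
  ∀ (x y : Fin m) → IsLeaf T x → IsLeaf T y → c (f x) ≡ c (f y)


-- Double star S_{a,b} on vertices Fin (a + b + 2):
--   0 = u, 1 = v, 2 .. a+1 = leaves at u, a+2 .. a+b+1 = leaves at v.
dsEdge : ℕ → ℕ → ℕ → Bool
dsEdge a x y =
     ((x ≡ᵇ 0) ∧ (y ≡ᵇ 1))
  ∨ ((x ≡ᵇ 0) ∧ ((2 ≤ᵇ y) ∧ (y ≤ᵇ suc a)))
  ∨ ((x ≡ᵇ 1) ∧ (suc (suc a) ≤ᵇ y))

DoubleStar : (a b : ℕ) → Graph (a + b + 2)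
adj (DoubleStar a b) i j = dsEdge a (toℕ i) (toℕ j) ∨ dsEdge a (toℕ j) (toℕ i)

-- Call a vertex light if 2 deg ≤ a + b, heavy if deg > a + b, and medium otherwise.
--
-- Key fact: a heavy vertex u has at most one non-light neighbour.  A non-light
-- neighbour v has more than a (or more than b) neighbours, so we may fix a set P
-- of a (resp. b) neighbours of v other than u, containing some x₀.  Every other
-- neighbour y of u can then be completed, together with P, to a copy of S_{a,b}
-- with centres v and u in which y and x₀ are leaves; hence c y = c x₀.  If u had
-- two non-light neighbours v ≠ v′, then with a third neighbour z of u we would get
-- c v = c x₀′ = c z = c x₀, although v and x₀ are adjacent.
--
-- Discharging: each edge carries two units of charge.  An edge between a heavy and
-- a light vertex gives both units to the light one; any other edge gives one unit
-- to each end.  A light vertex then receives at most 2 deg ≤ a + b, a medium one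
-- deg ≤ a + b, and a heavy one at most 1, so 2 e(G) ≤ (a + b) n.
module Submission where

open import Defs
import Data.Nat as ℕ
open import Data.Nat
  using (ℕ; zero; suc; _+_; _*_; _≤_; _<_; z≤n; s≤s; s≤s⁻¹; _≡ᵇ_; _<ᵇ_; NonZero)
open import Data.Nat.Properties hiding (<-cmp; _<?_; _≟_)
open import Data.Bool using (Bool; true; false; _∧_; _∨_; not; if_then_else_; T)
open import Data.Bool.Properties using (T?; T-≡; ∧-zeroʳ; ∨-identityʳ)
open import Data.Fin using (Fin; toℕ; cast; _<?_; _≟_) renaming (zero to fzero; suc to fsuc)
open import Data.Fin.Properties using (toℕ<n; toℕ-injective; toℕ-cast; cast-involutive; <-cmp)
open import Data.List as List using (length; filterᵇ; tabulate; concatMap)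
open import Data.List.Properties using (length-++; filter-++; map-tabulate)
open import Data.Vec using (Vec; []; _∷_; _++_; lookup)
open import Data.Vec.Properties using (lookup-++-<; lookup-++-≥)
open import Data.Vec.Relation.Unary.All as All using (All; []; _∷_)
open import Data.Vec.Relation.Unary.All.Properties as All using (All-swap)
open import Data.Vec.Relation.Unary.Any using (here; there; index)
open import Data.Vec.Relation.Unary.Any.Properties as Any using (lookup-index)
open import Data.Vec.Relation.Unary.AllPairs using ([]; _∷_)
import Data.Vec.Relation.Unary.AllPairs.Properties as AllPairs
open import Data.Vec.Relation.Unary.Unique.Propositional using (Unique)
open import Data.Vec.Relation.Unary.Unique.Propositional.Properties using (lookup-injective)
open import Data.Vec.Membership.Propositional using (_∈_; _∉_)
open import Data.Vec.Membership.Propositional.Properties using (∈-++⁺ˡ; ∈-++⁺ʳ; ∈-lookup)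
open import Data.Product using (∃; _×_; _,_)
open import Data.Sum using (_⊎_; inj₁; inj₂)
open import Data.Empty using (⊥-elim)
open import Function using (_∘_; id)
open import Function.Bundles using (Equivalence)
open import Relation.Nullary using (¬_; yes; no; does)
open import Relation.Nullary.Decidable using (dec-true; dec-false)
open import Relation.Binary.Definitions using (tri<; tri≈; tri>)
open import Relation.Binary.PropositionalEquality
open import Algebra.Properties.Semiring.Sum +-*-semiring
  using (sum-syntax; sum-cong-≗; sum-replicate-zero; ∑-distrib-+; ∑-comm; *-distribˡ-sum)

≡ᵇ-refl : ∀ m → (m ≡ᵇ m) ≡ true
≡ᵇ-refl zero = refl
≡ᵇ-refl (suc m) = ≡ᵇ-refl m

<ᵇ-true⇒< : ∀ {m n} → (m <ᵇ n) ≡ true → m < n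
<ᵇ-true⇒< {m} {n} h = <ᵇ⇒< m n (Equivalence.from T-≡ h)

<ᵇ-false⇒≮ : ∀ {m n} → (m <ᵇ n) ≡ false → ¬ m < n
<ᵇ-false⇒≮ h m<n = subst T h (<⇒<ᵇ m<n)

∧-true : ∀ {b c} → b ∧ c ≡ true → b ≡ true × c ≡ true
∧-true {true} {true} _ = refl , refl

∨-true : ∀ {b c} → b ∨ c ≡ true → b ≡ true ⊎ c ≡ true
∨-true {true} _ = inj₁ refl
∨-true {false} h = inj₂ h

-- Sums and counting over Fin n

𝟙 : Bool → ℕ
𝟙 true = 1
𝟙 false = 0

𝟙-mono : ∀ {b b′} → (b ≡ true → b′ ≡ true) → 𝟙 b ≤ 𝟙 b′
𝟙-mono {false} _ = z≤n
𝟙-mono {true} h rewrite h refl = s≤s z≤n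

∑-mono-≤ : ∀ {n} {f g : Fin n → ℕ} → (∀ i → f i ≤ g i) → ∑[ i < n ] f i ≤ ∑[ i < n ] g i
∑-mono-≤ {zero} _ = z≤n
∑-mono-≤ {suc n} f≤g = +-mono-≤ (f≤g fzero) (∑-mono-≤ (f≤g ∘ fsuc))

∑-bounded : ∀ {n} {f : Fin n → ℕ} k → (∀ i → f i ≤ k) → ∑[ i < n ] f i ≤ k * n
∑-bounded {zero} k _ = z≤n
∑-bounded {suc n} k f≤k rewrite *-suc k n = +-mono-≤ (f≤k fzero) (∑-bounded k (f≤k ∘ fsuc))

∑∑-symmetrise : ∀ {n} (f : Fin n → Fin n → ℕ) →
  ∑[ i < n ] ∑[ j < n ] (f i j + f j i) ≡ 2 * ∑[ i < n ] ∑[ j < n ] f i j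
∑∑-symmetrise {n} f = begin
  ∑[ i < n ] ∑[ j < n ] (f i j + f j i)             ≡⟨ sum-cong-≗ (λ i → ∑-distrib-+ (f i) (λ j → f j i)) ⟩
  ∑[ i < n ] (∑[ j < n ] f i j + ∑[ j < n ] f j i)  ≡⟨ ∑-distrib-+ {n} _ _ ⟩
  S + ∑[ i < n ] ∑[ j < n ] f j i                   ≡⟨ cong (S +_) (∑-comm (λ i j → f j i)) ⟩
  S + S                                             ≡⟨ cong (S +_) (+-identityʳ S) ⟨
  2 * S                                             ∎
  where
  open ≡-Reasoning
  S : ℕ
  S = ∑[ i < n ] ∑[ j < n ] f i j

∑∑-cong-symmetrised : ∀ {n} (f g : Fin n → Fin n → ℕ) → (∀ i j → f i j + f j i ≡ g i j + g j i) →
  ∑[ i < n ] ∑[ j < n ] f i j ≡ ∑[ i < n ] ∑[ j < n ] g i j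
∑∑-cong-symmetrised {n} f g f≡g = *-cancelˡ-≡ _ _ 2 (begin
  2 * ∑[ i < n ] ∑[ j < n ] f i j        ≡⟨ ∑∑-symmetrise f ⟨
  ∑[ i < n ] ∑[ j < n ] (f i j + f j i)  ≡⟨ sum-cong-≗ (λ i → sum-cong-≗ (f≡g i)) ⟩
  ∑[ i < n ] ∑[ j < n ] (g i j + g j i)  ≡⟨ ∑∑-symmetrise g ⟩
  2 * ∑[ i < n ] ∑[ j < n ] g i j        ∎)
  where open ≡-Reasoning

count : ∀ {n} → (Fin n → Bool) → ℕ
count {n} p = ∑[ i < n ] 𝟙 (p i)

count-toℕ≡ᵇ : ∀ {n} t → t < n → count {n} (λ j → toℕ j ≡ᵇ t) ≡ 1
count-toℕ≡ᵇ {suc n} zero _ = cong suc (sum-replicate-zero n)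
count-toℕ≡ᵇ {suc n} (suc t) (s≤s t<n) = count-toℕ≡ᵇ t t<n

count-witness : ∀ {n} (p : Fin n → Bool) → 0 < count p → ∃ λ i → p i ≡ true
count-witness {suc n} p pos with p fzero in p0
... | true = fzero , p0
... | false with i , pi ← count-witness (p ∘ fsuc) pos = fsuc i , pi

count-≤1 : ∀ {n} (p : Fin n → Bool) → (∀ {i j} → p i ≡ true → p j ≡ true → i ≡ j) → count p ≤ 1
count-≤1 {n} p unique with 1 ≤? count p
... | no ¬pos = ≤-trans (≮⇒≥ ¬pos) z≤n
... | yes pos with x , px ← count-witness p pos = begin
  count p                               ≤⟨ ∑-mono-≤ (λ j → 𝟙-mono (only-x j)) ⟩
  count {n} (λ j → toℕ j ≡ᵇ toℕ x)      ≡⟨ count-toℕ≡ᵇ (toℕ x) (toℕ<n x) ⟩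
  1                                     ∎
  where
  open ≤-Reasoning
  only-x : ∀ j → p j ≡ true → (toℕ j ≡ᵇ toℕ x) ≡ true
  only-x j pj rewrite unique pj px = ≡ᵇ-refl (toℕ x)

count-split : ∀ {n} (p q : Fin n → Bool) → count p ≤ count (λ j → p j ∧ not (q j)) + count q
count-split {n} p q = begin
  count p                                      ≤⟨ ∑-mono-≤ (λ j → split (p j) (q j)) ⟩
  ∑[ j < n ] (𝟙 (p j ∧ not (q j)) + 𝟙 (q j))  ≡⟨ ∑-distrib-+ {n} _ _ ⟩
  count (λ j → p j ∧ not (q j)) + count q      ∎
  where
  open ≤-Reasoning
  split : ∀ b c → 𝟙 b ≤ 𝟙 (b ∧ not c) + 𝟙 c
  split false c = z≤n
  split true false = s≤s z≤n
  split true true = s≤s z≤n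

_without_ : ∀ {n} → (Fin n → Bool) → Fin n → Fin n → Bool
(p without e) j = p j ∧ not (toℕ j ≡ᵇ toℕ e)

count-without : ∀ {n} (p : Fin n → Bool) e → count p ≤ suc (count (p without e))
count-without {n} p e = begin
  count p                              ≤⟨ count-split p is-e ⟩
  count (p without e) + count is-e     ≡⟨ cong (count (p without e) +_) (count-toℕ≡ᵇ (toℕ e) (toℕ<n e)) ⟩
  count (p without e) + 1              ≡⟨ +-comm (count (p without e)) 1 ⟩
  suc (count (p without e))            ∎
  where
  open ≤-Reasoning
  is-e : Fin n → Bool
  is-e j = toℕ j ≡ᵇ toℕ e

without-true : ∀ {n} {p : Fin n → Bool} {e x} → (p without e) x ≡ true → p x ≡ true × e ≢ x
without-true {p = p} {e} {x} h with p x | toℕ x ≡ᵇ toℕ e in x≢ᵇe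
... | true | false = refl , λ { refl → subst T (trans (sym (≡ᵇ-refl (toℕ x))) x≢ᵇe) _ }

∃-avoiding : ∀ {n m} (p : Fin n → Bool) (E : Vec (Fin n) m) → m < count p →
  ∃ λ x → p x ≡ true × All (_≢ x) E
∃-avoiding p [] pos with x , px ← count-witness p pos = x , px , []
∃-avoiding p (e ∷ E) m<count
  with x , px′ , x∉E ← ∃-avoiding (p without e) E (s≤s⁻¹ (≤-trans m<count (count-without p e)))
  with px , e≢x ← without-true {p = p} px′
  = x , px , e≢x ∷ x∉E

-- Handshake lemma and discharging

length-filterᵇ-tabulate : ∀ {A : Set} {n} (p : A → Bool) (f : Fin n → A) →
  length (filterᵇ p (tabulate f)) ≡ ∑[ i < n ] 𝟙 (p (f i))
length-filterᵇ-tabulate {n = zero} p f = refl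
length-filterᵇ-tabulate {n = suc n} p f with p (f fzero)
... | true = cong suc (length-filterᵇ-tabulate p (f ∘ fsuc))
... | false = length-filterᵇ-tabulate p (f ∘ fsuc)

length-filterᵇ-pairs : ∀ {A B : Set} {m n} (p : A × B → Bool) (f : Fin m → A) (g : Fin n → B) →
  length (filterᵇ p (concatMap (λ i → List.map (i ,_) (tabulate g)) (tabulate f)))
    ≡ ∑[ i < m ] ∑[ j < n ] 𝟙 (p (f i , g j))
length-filterᵇ-pairs {m = zero} p f g = refl
length-filterᵇ-pairs {A} {B} {suc m} {n} p f g = begin
  length (filterᵇ p (row List.++ rows))                    ≡⟨ cong length (filter-++ (T? ∘ p) row rows) ⟩
  length (filterᵇ p row List.++ filterᵇ p rows)            ≡⟨ length-++ (filterᵇ p row) ⟩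
  length (filterᵇ p row) + length (filterᵇ p rows)         ≡⟨ cong₂ _+_ first rest ⟩
  ∑[ j < n ] 𝟙 (p (f fzero , g j)) + ∑[ i < m ] ∑[ j < n ] 𝟙 (p (f (fsuc i) , g j)) ∎
  where
  open ≡-Reasoning
  row rows : List.List (A × B)
  row = List.map (f fzero ,_) (tabulate g)
  rows = concatMap (λ i → List.map (i ,_) (tabulate g)) (tabulate (f ∘ fsuc))
  first : length (filterᵇ p row) ≡ ∑[ j < n ] 𝟙 (p (f fzero , g j))
  first = trans (cong (length ∘ filterᵇ p) (map-tabulate g (f fzero ,_)))
                (length-filterᵇ-tabulate p (λ j → f fzero , g j))
  rest : length (filterᵇ p rows) ≡ ∑[ i < m ] ∑[ j < n ] 𝟙 (p (f (fsuc i) , g j))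
  rest = length-filterᵇ-pairs p (f ∘ fsuc) g

degree≡count : ∀ {n} (G : Graph n) v → degree G v ≡ count (adj G v)
degree≡count G v = length-filterᵇ-tabulate (adj G v) id

numEdges≡∑∑ : ∀ {n} (G : Graph n) → numEdges G ≡ ∑[ i < n ] ∑[ j < n ] 𝟙 (does (i <? j) ∧ adj G i j)
numEdges≡∑∑ G = length-filterᵇ-pairs (λ (i , j) → does (i <? j) ∧ adj G i j) id id

ordered-edge-split : ∀ {n} (G : Graph n) → IsSimple G → ∀ i j →
  𝟙 (does (i <? j) ∧ adj G i j) + 𝟙 (does (j <? i) ∧ adj G j i) ≡ 𝟙 (adj G i j)
ordered-edge-split G (symmetric , irreflexive) i j with <-cmp i j
... | tri< i<j _ j≮i rewrite dec-true (i <? j) i<j | dec-false (j <? i) j≮i = +-identityʳ _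
... | tri> i≮j _ j<i rewrite dec-false (i <? j) i≮j | dec-true (j <? i) j<i | symmetric j i = refl
... | tri≈ _ refl _ rewrite irreflexive i | ∧-zeroʳ (does (i <? i)) = refl

handshake : ∀ {n} (G : Graph n) → IsSimple G → 2 * numEdges G ≡ ∑[ i < n ] degree G i
handshake {n} G simple = begin
  2 * numEdges G                  ≡⟨ cong (2 *_) (numEdges≡∑∑ G) ⟩
  2 * ∑[ i < n ] ∑[ j < n ] L i j  ≡⟨ ∑∑-symmetrise L ⟨
  ∑[ i < n ] ∑[ j < n ] (L i j + L j i)
                                  ≡⟨ sum-cong-≗ (λ i → sum-cong-≗ (ordered-edge-split G simple i)) ⟩
  ∑[ i < n ] count (adj G i)      ≡⟨ sum-cong-≗ (degree≡count G) ⟨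
  ∑[ i < n ] degree G i           ∎
  where
  open ≡-Reasoning
  L : Fin n → Fin n → ℕ
  L i j = 𝟙 (does (i <? j) ∧ adj G i j)

data Load : Set where
  light medium heavy : Load

nonLight : Load → Bool
nonLight light = false
nonLight _     = true

-- The charge an edge xy passes to x, as a function of the loads of x and y.
share : Load → Load → ℕ
share heavy light = 0
share light heavy = 2
share _     _     = 1

share-sum : ∀ ℓ ℓ′ → share ℓ ℓ′ + share ℓ′ ℓ ≡ 2
share-sum light  light  = refl
share-sum light  medium = refl
share-sum light  heavy  = refl
share-sum medium light  = refl
share-sum medium medium = refl
share-sum medium heavy  = refl
share-sum heavy  light  = refl
share-sum heavy  medium = refl
share-sum heavy  heavy  = refl

𝟙-transfer : ∀ e ℓ ℓ′ → 𝟙 e + 𝟙 e ≡ 𝟙 e * share ℓ ℓ′ + 𝟙 e * share ℓ′ ℓ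
𝟙-transfer false ℓ ℓ′ = refl
𝟙-transfer true ℓ ℓ′ =
  sym (trans (cong₂ _+_ (*-identityˡ (share ℓ ℓ′)) (*-identityˡ (share ℓ′ ℓ))) (share-sum ℓ ℓ′))

heavy-share : ∀ e ℓ → 𝟙 e * share heavy ℓ ≡ 𝟙 (e ∧ nonLight ℓ)
heavy-share false ℓ = refl
heavy-share true light = refl
heavy-share true medium = refl
heavy-share true heavy = refl

medium-share : ∀ e ℓ → 𝟙 e * share medium ℓ ≡ 𝟙 e
medium-share false ℓ = refl
medium-share true ℓ = refl

light-share : ∀ e ℓ → 𝟙 e * share light ℓ ≤ 2 * 𝟙 e
light-share false ℓ = z≤n
light-share true light = s≤s z≤n
light-share true medium = s≤s z≤n
light-share true heavy = ≤-refl

module _ (k : ℕ) where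

  loadOf : ℕ → Load
  loadOf d with 2 * d ℕ.≤? k | k ℕ.<? d
  ... | yes _ | _     = light
  ... | no _  | yes _ = heavy
  ... | no _  | no _  = medium

  data LoadView (d : ℕ) : Load → Set where
    light  : 2 * d ≤ k → LoadView d light
    medium : k < 2 * d → d ≤ k → LoadView d medium
    heavy  : k < 2 * d → k < d → LoadView d heavy

  loadView : ∀ d → LoadView d (loadOf d)
  loadView d with 2 * d ℕ.≤? k | k ℕ.<? d
  ... | yes 2d≤k | _       = light 2d≤k
  ... | no 2d≰k  | yes k<d = heavy (≰⇒> 2d≰k) k<d
  ... | no 2d≰k  | no k≮d  = medium (≰⇒> 2d≰k) (≮⇒≥ k≮d)

  nonLight-view : ∀ {d ℓ} → LoadView d ℓ → nonLight ℓ ≡ true → k < 2 * d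
  nonLight-view (medium k<2d _) _ = k<2d
  nonLight-view (heavy k<2d _) _ = k<2d

module _ {n} (G : Graph n) (k : ℕ) where

  load : Fin n → Load
  load x = loadOf k (degree G x)

  charge : Fin n → ℕ
  charge x = ∑[ y < n ] (𝟙 (adj G x y) * share (load x) (load y))

  AtMostOneNonLightNeighbour : Set
  AtMostOneNonLightNeighbour = ∀ {x y y′} → k < degree G x → Adj G x y → Adj G x y′ →
    k < 2 * degree G y → k < 2 * degree G y′ → y ≡ y′

  charge-≤ : 0 < k → AtMostOneNonLightNeighbour → ∀ x → charge x ≤ k
  charge-≤ k>0 one x = bound (loadView k (degree G x))
    where
    open ≤-Reasoning
    bound : ∀ {ℓ} → LoadView k (degree G x) ℓ → ∑[ y < n ] (𝟙 (adj G x y) * share ℓ (load y)) ≤ k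
    bound (light 2d≤k) = begin
      ∑[ y < n ] (𝟙 (adj G x y) * share light (load y))  ≤⟨ ∑-mono-≤ (λ y → light-share (adj G x y) (load y)) ⟩
      ∑[ y < n ] (2 * 𝟙 (adj G x y))                     ≡⟨ *-distribˡ-sum 2 (𝟙 ∘ adj G x) ⟨
      2 * count (adj G x)                                ≡⟨ cong (2 *_) (degree≡count G x) ⟨
      2 * degree G x                                     ≤⟨ 2d≤k ⟩
      k                                                  ∎
    bound (medium _ d≤k) = begin
      ∑[ y < n ] (𝟙 (adj G x y) * share medium (load y)) ≡⟨ sum-cong-≗ (λ y → medium-share (adj G x y) (load y)) ⟩
      count (adj G x)                                    ≡⟨ degree≡count G x ⟨
      degree G x                                         ≤⟨ d≤k ⟩
      k                                                  ∎
    bound (heavy _ k<d) = begin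
      ∑[ y < n ] (𝟙 (adj G x y) * share heavy (load y))  ≡⟨ sum-cong-≗ (λ y → heavy-share (adj G x y) (load y)) ⟩
      count (λ y → adj G x y ∧ nonLight (load y))        ≤⟨ count-≤1 _ unique ⟩
      1                                                  ≤⟨ k>0 ⟩
      k                                                  ∎
      where
      nonLight⇒ : ∀ {y} → nonLight (load y) ≡ true → k < 2 * degree G y
      nonLight⇒ {y} = nonLight-view k (loadView k (degree G y))
      unique : ∀ {y y′} → (adj G x y ∧ nonLight (load y)) ≡ true →
        (adj G x y′ ∧ nonLight (load y′)) ≡ true → y ≡ y′
      unique h h′ with xy , ly ← ∧-true h | xy′ , ly′ ← ∧-true h′ =
        one k<d xy xy′ (nonLight⇒ ly) (nonLight⇒ ly′)

  discharging : IsSimple G → 0 < k → AtMostOneNonLightNeighbour → 2 * numEdges G ≤ k * n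
  discharging simple@(symmetric , _) k>0 one = begin
    2 * numEdges G                       ≡⟨ handshake G simple ⟩
    ∑[ x < n ] degree G x                ≡⟨ sum-cong-≗ (degree≡count G) ⟩
    ∑[ x < n ] ∑[ y < n ] 𝟙 (adj G x y)  ≡⟨ ∑∑-cong-symmetrised _ _ transfer ⟩
    ∑[ x < n ] charge x                  ≤⟨ ∑-bounded k (charge-≤ k>0 one) ⟩
    k * n                                ∎
    where
    open ≤-Reasoning
    transfer : ∀ x y → 𝟙 (adj G x y) + 𝟙 (adj G y x)
      ≡ 𝟙 (adj G x y) * share (load x) (load y) + 𝟙 (adj G y x) * share (load y) (load x)
    transfer x y rewrite symmetric y x = 𝟙-transfer (adj G x y) (load x) (load y)

-- Copies of the double star

adj-sym : ∀ {n} {G : Graph n} → IsSimple G → ∀ {x y} → Adj G x y → Adj G y x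
adj-sym (symmetric , _) {x} {y} xy = trans (symmetric y x) xy

adj⇒≢ : ∀ {n} {G : Graph n} → IsSimple G → ∀ {x y} → Adj G x y → x ≢ y
adj⇒≢ (_ , irreflexive) {x} xx refl = subst T (trans (sym xx) (irreflexive x)) _

leaf : ∀ a b → Fin (a + b) → Fin (a + b + 2)
leaf a b k = cast (+-comm 2 (a + b)) (fsuc (fsuc k))

leafCentre : ℕ → ℕ → ℕ
leafCentre a t = if t <ᵇ a then 0 else 1

leafCentre<2 : ∀ a t → leafCentre a t < 2
leafCentre<2 a t with t <ᵇ a
... | true = s≤s z≤n
... | false = ≤-refl

DoubleStar-leaf-adj : ∀ a t j → dsEdge a (2 + t) j ∨ dsEdge a j (2 + t) ≡ (j ≡ᵇ leafCentre a t)
DoubleStar-leaf-adj a t zero with t <ᵇ a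
... | true = refl
... | false = refl
DoubleStar-leaf-adj a t (suc zero) with t <ᵇ a in t<ᵇa | a <ᵇ suc t in a<ᵇ1+t
... | true  | false = refl
... | false | true  = refl
... | true  | true  = ⊥-elim (<⇒≱ (<ᵇ-true⇒< {t} t<ᵇa) (s≤s⁻¹ (<ᵇ-true⇒< {a} a<ᵇ1+t)))
... | false | false = ⊥-elim (<ᵇ-false⇒≮ {a} a<ᵇ1+t (s≤s (≮⇒≥ (<ᵇ-false⇒≮ {t} t<ᵇa))))
DoubleStar-leaf-adj a t (suc (suc s)) with t <ᵇ a
... | true = refl
... | false = refl

leaf-isLeaf : ∀ {a b} (k : Fin (a + b)) → IsLeaf (DoubleStar a b) (leaf a b k)
leaf-isLeaf {a} {b} k = begin
  degree S x                                              ≡⟨ degree≡count S x ⟩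
  count (adj S x)                                         ≡⟨ sum-cong-≗ (cong 𝟙 ∘ x-adj) ⟩
  count {a + b + 2} (λ j → toℕ j ≡ᵇ leafCentre a (toℕ k)) ≡⟨ count-toℕ≡ᵇ _ centre<size ⟩
  1                                                       ∎
  where
  open ≡-Reasoning
  S : Graph (a + b + 2)
  S = DoubleStar a b
  x : Fin (a + b + 2)
  x = leaf a b k
  x-adj : ∀ j → adj S x j ≡ (toℕ j ≡ᵇ leafCentre a (toℕ k))
  x-adj j rewrite toℕ-cast (+-comm 2 (a + b)) (fsuc (fsuc k)) = DoubleStar-leaf-adj a (toℕ k) (toℕ j)
  centre<size : leafCentre a (toℕ k) < a + b + 2
  centre<size = ≤-trans (leafCentre<2 a (toℕ k)) (m≤n+m 2 (a + b))

record DoubleStarAt {n α β} (G : Graph n) (u v : Fin n) (P : Vec (Fin n) α) (Q : Vec (Fin n) β) : Set where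
  field
    centres    : Adj G u v
    P-around-u : All (Adj G u) P
    Q-around-v : All (Adj G v) Q
    v∉P        : All (v ≢_) P
    u∉Q        : All (u ≢_) Q
    P-unique   : Unique P
    Q-unique   : Unique Q
    P∩Q≡∅      : All (λ p → All (p ≢_) Q) P

module _ {n α β} {G : Graph n} (simple : IsSimple G) {u v} {P : Vec (Fin n) α} {Q : Vec (Fin n) β}
         (S : DoubleStarAt G u v P Q) where
  open DoubleStarAt S

  DoubleStarAt-swap : DoubleStarAt G v u Q P
  DoubleStarAt-swap = record
    { centres    = adj-sym simple centres
    ; P-around-u = Q-around-v
    ; Q-around-v = P-around-u
    ; v∉P        = u∉Q
    ; u∉Q        = v∉P
    ; P-unique   = Q-unique
    ; Q-unique   = P-unique
    ; P∩Q≡∅      = All.map (All.map ≢-sym) (All-swap P∩Q≡∅)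
    }

  DoubleStarAt-unique : Unique (u ∷ v ∷ P ++ Q)
  DoubleStarAt-unique =
      (adj⇒≢ simple centres ∷ All.++⁺ (All.map (adj⇒≢ simple) P-around-u) u∉Q)
    ∷ All.++⁺ v∉P (All.map (adj⇒≢ simple) Q-around-v)
    ∷ AllPairs.++⁺ P-unique Q-unique P∩Q≡∅

module _ {n a b} {G : Graph n} (simple : IsSimple G) {u v} {P : Vec (Fin n) a} {Q : Vec (Fin n) b}
         (S : DoubleStarAt G u v P Q) where
  open DoubleStarAt S

  private
    vertices : Vec (Fin n) (2 + (a + b))
    vertices = u ∷ v ∷ P ++ Q

    lookup-adj : ∀ i j → dsEdge a (toℕ i) (toℕ j) ≡ true → Adj G (lookup vertices i) (lookup vertices j)
    lookup-adj fzero (fsuc fzero) _ = centres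
    lookup-adj fzero (fsuc (fsuc k)) h =
      subst (Adj G u) (sym (lookup-++-< P Q k k<a)) (All.lookup⁺ P-around-u _)
      where
      k<a : toℕ k < a
      k<a = <ᵇ-true⇒< (trans (sym (∨-identityʳ _)) h)
    lookup-adj (fsuc fzero) (fsuc (fsuc k)) h =
      subst (Adj G v) (sym (lookup-++-≥ P Q k a≤k)) (All.lookup⁺ Q-around-v _)
      where
      a≤k : a ≤ toℕ k
      a≤k = s≤s⁻¹ (<ᵇ-true⇒< h)

    reindex : Fin (a + b + 2) → Fin (2 + (a + b))
    reindex = cast (+-comm (a + b) 2)

  embed : Fin (a + b + 2) → Fin n
  embed = lookup vertices ∘ reindex

  embed-copy : IsCopy (DoubleStar a b) G embed
  embed-copy = injective , preserves
    where
    injective : ∀ {x y} → embed x ≡ embed y → x ≡ y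
    injective {x} {y} e = toℕ-injective (begin
      toℕ x            ≡⟨ toℕ-cast _ x ⟨
      toℕ (reindex x)  ≡⟨ cong toℕ (lookup-injective (DoubleStarAt-unique simple S) _ _ e) ⟩
      toℕ (reindex y)  ≡⟨ toℕ-cast _ y ⟩
      toℕ y            ∎)
      where open ≡-Reasoning
    edge : ∀ x y → dsEdge a (toℕ x) (toℕ y) ≡ true → Adj G (embed x) (embed y)
    edge x y = lookup-adj (reindex x) (reindex y)
             ∘ subst₂ (λ s t → dsEdge a s t ≡ true) (sym (toℕ-cast _ x)) (sym (toℕ-cast _ y))
    preserves : ∀ x y → Adj (DoubleStar a b) x y → Adj G (embed x) (embed y)
    preserves x y h with ∨-true h
    ... | inj₁ xy = edge x y xy
    ... | inj₂ yx = adj-sym simple (edge y x yx)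

  embed-leaf : ∀ k → embed (leaf a b k) ≡ lookup (P ++ Q) k
  embed-leaf k = cong (lookup vertices) (cast-involutive (+-comm (a + b) 2) (+-comm 2 (a + b)) (fsuc (fsuc k)))

MonochromaticStars : ∀ {n} → Graph n → (Fin n → ℕ) → ℕ → ℕ → Set
MonochromaticStars {n} G c α β = ∀ {u v} {P : Vec (Fin n) α} {Q : Vec (Fin n) β} → DoubleStarAt G u v P Q →
  ∀ {x y} → x ∈ P ++ Q → y ∈ P ++ Q → c x ≡ c y

monochromaticStars : ∀ {n a b} {G : Graph n} {c} → IsSimple G → LeavesMonochromatic (DoubleStar a b) G c →
  MonochromaticStars G c a b
monochromaticStars {n} {a} {b} {c = c} simple mono {P = P} {Q} S {x} {y} x∈ y∈ = begin
  c x                    ≡⟨ cong c (lookup-index x∈) ⟩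
  c (lookup (P ++ Q) i)  ≡⟨ cong c (embed-leaf simple S i) ⟨
  c (f (leaf a b i))     ≡⟨ mono f (embed-copy simple S) _ _ (leaf-isLeaf {a} {b} i) (leaf-isLeaf {a} {b} j) ⟩
  c (f (leaf a b j))     ≡⟨ cong c (embed-leaf simple S j) ⟩
  c (lookup (P ++ Q) j)  ≡⟨ cong c (lookup-index y∈) ⟨
  c y                    ∎
  where
  open ≡-Reasoning
  f : Fin (a + b + 2) → Fin n
  f = embed simple S
  i j : Fin (a + b)
  i = index x∈
  j = index y∈

∈-++-comm : ∀ {A : Set} {m k} {x : A} (xs : Vec A m) {ys : Vec A k} → x ∈ xs ++ ys → x ∈ ys ++ xs
∈-++-comm xs {ys} x∈ with Any.++⁻ xs x∈
... | inj₁ x∈xs = ∈-++⁺ʳ ys x∈xs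
... | inj₂ x∈ys = ∈-++⁺ˡ x∈ys

MonochromaticStars-swap : ∀ {n α β} {G : Graph n} {c} → IsSimple G →
  MonochromaticStars G c α β → MonochromaticStars G c β α
MonochromaticStars-swap simple mono {P = P} S x∈ y∈ =
  mono (DoubleStarAt-swap simple S) (∈-++-comm P x∈) (∈-++-comm P y∈)

-- Colours forced at a heavy vertex

record FreshNeighbours {n m k} (G : Graph n) (w : Fin n) (E : Vec (Fin n) m) (xs : Vec (Fin n) k) : Set where
  field
    unique   : Unique xs
    adjacent : All (Adj G w) xs
    avoid    : All (λ e → All (e ≢_) xs) E

fresh-∷ : ∀ {n m k} {G : Graph n} {w x} {E : Vec (Fin n) m} {xs : Vec (Fin n) k} →
  Adj G w x → All (_≢ x) E → FreshNeighbours G w (x ∷ E) xs → FreshNeighbours G w E (x ∷ xs)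
fresh-∷ wx x∉E F = record
  { unique   = All.head avoid ∷ unique
  ; adjacent = wx ∷ adjacent
  ; avoid    = All.map (λ (e≢x , e∉xs) → e≢x ∷ e∉xs) (All.zip (x∉E , All.tail avoid))
  }
  where open FreshNeighbours F

module _ {n} (G : Graph n) where

  pick : ∀ k {m} w (E : Vec (Fin n) m) → k + m ≤ degree G w → ∃ (FreshNeighbours {k = k} G w E)
  pick zero w E _ = [] , record { unique = [] ; adjacent = [] ; avoid = All.universal (λ _ → []) E }
  pick (suc k) {m} w E 1+k+m≤d
    with x , wx , x∉E ← ∃-avoiding (adj G w) E
                          (subst (suc m ≤_) (degree≡count G w) (≤-trans (s≤s (m≤n+m m k)) 1+k+m≤d))
    with xs , F ← pick k w (x ∷ E) (subst (_≤ degree G w) (sym (+-suc k m)) 1+k+m≤d)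
    = x ∷ xs , fresh-∷ wx x∉E F

  pick∋ : ∀ k {m w y} (E : Vec (Fin n) m) → Adj G w y → All (_≢ y) E → suc k + m ≤ degree G w →
    ∃ λ xs → FreshNeighbours G w E xs × y ∈ xs
  pick∋ k {m} {w} E wy y∉E 1+k+m≤d
    with xs , F ← pick k w (_ ∷ E) (subst (_≤ degree G w) (sym (+-suc k m)) 1+k+m≤d)
    = _ ∷ xs , fresh-∷ wy y∉E F , here refl

∉⇒All≢ : ∀ {A : Set} {k} {x : A} {xs : Vec A k} → x ∉ xs → All (_≢ x) xs
∉⇒All≢ {xs = []} _ = []
∉⇒All≢ {xs = y ∷ xs} x∉ = (λ y≡x → x∉ (here (sym y≡x))) ∷ ∉⇒All≢ (x∉ ∘ there)

module _ {n} {G : Graph n} (simple : IsSimple G) {c : Fin n → ℕ} where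
  open FreshNeighbours
  open import Data.Vec.Membership.DecPropositional (_≟_ {n}) using (_∈?_)

  fresh-DoubleStarAt : ∀ {α β u v} {P : Vec (Fin n) α} {Q : Vec (Fin n) β} → Adj G v u →
    FreshNeighbours G v (u ∷ []) P → FreshNeighbours G u (v ∷ P) Q → DoubleStarAt G v u P Q
  fresh-DoubleStarAt vu FP FQ = record
    { centres    = vu
    ; P-around-u = adjacent FP
    ; Q-around-v = adjacent FQ
    ; v∉P        = All.head (avoid FP)
    ; u∉Q        = All.head (avoid FQ)
    ; P-unique   = unique FP
    ; Q-unique   = unique FQ
    ; P∩Q≡∅      = All.tail (avoid FQ)
    }

  ColourForcedAt : Fin n → Fin n → Set
  ColourForcedAt u v = ∃ λ x₀ → Adj G v x₀ × (∀ {y} → Adj G u y → y ≢ v → c y ≡ c x₀)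

  colour-forced : ∀ {α β u v} → MonochromaticStars G c α β → 0 < α → 0 < β →
    Adj G v u → α < degree G v → α + β < degree G u → ColourForcedAt u v
  colour-forced {suc α} {suc β} {u} {v} mono _ _ vu α<dv α+β<du
    with P , FP ← pick G (suc α) v (u ∷ []) (subst (_≤ degree G v) (+-comm 1 (suc α)) α<dv)
    = lookup P fzero , All.lookup⁺ (adjacent FP) fzero , same
    where
    Q-bound : suc β + suc (suc α) ≤ degree G u
    Q-bound = subst (_≤ degree G u) (+-comm (suc (suc α)) (suc β)) α+β<du
    cover : ∀ {y} → Adj G u y → y ≢ v → ∃ λ Q → FreshNeighbours G u (v ∷ P) Q × y ∈ P ++ Q
    cover {y} uy y≢v with y ∈? P
    ... | yes y∈P with Q , FQ ← pick G (suc β) u (v ∷ P) Q-bound = Q , FQ , ∈-++⁺ˡ y∈P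
    ... | no y∉P with Q , FQ , y∈Q ← pick∋ G β (v ∷ P) uy (≢-sym y≢v ∷ ∉⇒All≢ y∉P) Q-bound =
      Q , FQ , ∈-++⁺ʳ P y∈Q
    same : ∀ {y} → Adj G u y → y ≢ v → c y ≡ c (lookup P fzero)
    same uy y≢v with Q , FQ , y∈ ← cover uy y≢v =
      mono (fresh-DoubleStarAt vu FP FQ) y∈ (∈-++⁺ˡ (∈-lookup fzero P))

nonLight-split : ∀ a b d → a + b < 2 * d → a < d ⊎ b < d
nonLight-split a b d a+b<2d with a ℕ.<? d | b ℕ.<? d
... | yes a<d | _       = inj₁ a<d
... | no _    | yes b<d = inj₂ b<d
... | no a≮d  | no b≮d  = ⊥-elim (<⇒≱ a+b<2d (begin
  2 * d  ≡⟨ cong (d +_) (+-identityʳ d) ⟩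
  d + d  ≤⟨ +-mono-≤ (≮⇒≥ a≮d) (≮⇒≥ b≮d) ⟩
  a + b  ∎))
  where open ≤-Reasoning

module _ {n a b} {G : Graph n} (simple : IsSimple G) {c : Fin n → ℕ} (a>0 : 0 < a) (b>0 : 0 < b)
         (proper : ProperColoring G c) (mono : LeavesMonochromatic (DoubleStar a b) G c) where

  colour-forced-by-nonLight : ∀ {u v} → a + b < degree G u → Adj G u v → a + b < 2 * degree G v →
    ColourForcedAt simple {c} u v
  colour-forced-by-nonLight {u} {v} a+b<du uv nl with nonLight-split a b (degree G v) nl
  ... | inj₁ a<dv = colour-forced simple stars a>0 b>0 (adj-sym simple uv) a<dv a+b<du
    where
    stars : MonochromaticStars G c a b
    stars = monochromaticStars simple mono
  ... | inj₂ b<dv =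
    colour-forced simple stars b>0 a>0 (adj-sym simple uv) b<dv (subst (_< degree G u) (+-comm a b) a+b<du)
    where
    stars : MonochromaticStars G c b a
    stars = MonochromaticStars-swap simple (monochromaticStars simple mono)

  atMostOneNonLightNeighbour : AtMostOneNonLightNeighbour G (a + b)
  atMostOneNonLightNeighbour {u} {v} {v′} a+b<du uv uv′ nl nl′ with v ≟ v′
  ... | yes v≡v′ = v≡v′
  ... | no v≢v′
    with x₀ , vx₀ , col ← colour-forced-by-nonLight a+b<du uv nl
       | x₀′ , _ , col′ ← colour-forced-by-nonLight a+b<du uv′ nl′
       | z , uz , v≢z ∷ v′≢z ∷ [] ← ∃-avoiding (adj G u) (v ∷ v′ ∷ [])
           (subst (2 <_) (degree≡count G u) (≤-trans (s≤s (+-mono-≤ a>0 b>0)) a+b<du))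
    = ⊥-elim (proper v x₀ vx₀ (begin
      c v    ≡⟨ col′ uv v≢v′ ⟩
      c x₀′  ≡⟨ col′ uz (≢-sym v′≢z) ⟨
      c z    ≡⟨ col uz (≢-sym v≢z) ⟩
      c x₀   ∎))
    where open ≡-Reasoning

theorem9 : (a b : ℕ) → .{{_ : NonZero a}} → .{{_ : NonZero b}} →
    ∀ (n : ℕ) (G : Graph n) (c : Fin n → ℕ) →
    IsSimple G → ProperColoring G c → LeavesMonochromatic (DoubleStar a b) G c →
    2 * numEdges G ≤ (a + b) * n
theorem9 a b n G c simple proper mono =
  discharging G (a + b) simple (≤-trans a>0 (m≤m+n a b))
    (atMostOneNonLightNeighbour simple a>0 b>0 proper mono)
  where
  a>0 : 0 < a
  a>0 = ℕ.>-nonZero⁻¹ a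
  b>0 : 0 < b
  b>0 = ℕ.>-nonZero⁻¹ b
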